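{- Let $x$ be a nonnegative integer and let $\mu$ be an umbra with $\mathbf{E}[\mu^i]=m_i$ where each $m_i$ is a nonnegative integer. Let $\mu_1,\mu_2,\dots$ be distinct umbrae exchangeable with $\mu$. Then for each $n\ge1$, $\mathbf{E}[x(x+\mu_1)(x+\mu_1+\mu_2)\cdots(x+\mu_1+\cdots+\mu_{n-1})]$ equals the number of labeled (rooted) forests on the vertex set $\{1,\dots,n\}$ in which each tree is assigned one of $x$ colors, each vertex of outdegree $j$ is assigned one of $m_j$ colors, and each parent vertex has a smaller label than each of its children.
   Context: Umbrae are formal symbols; the polynomial ring in the umbrae carries a linear evaluation map $\mathbf{E}$ with $\mathbf{E}[1]=1$ and $\mathbf{E}[MM']=\mathbf{E}[M]\mathbf{E}[M']$ for monomials $M,M'$ with no umbra in common (so distinct umbrae behave as independent random variables); every sequence $1,m_1,m_2,\dots$ is represented by some umbra. An umbra $\mu_i$ is exchangeable with $\mu$ if $\mathbf{E}[\mu_i^k]=\mathbf{E}[\mu^k]$ for all $k\ge0$ (in particular $m_0=1$). -}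

module Defs where

open import Data.Nat using (ℕ; zero; suc; _+_; _*_; _^_; _<ᵇ_)
open import Data.Fin using (Fin; zero; suc; toℕ; _≟_)
open import Data.Maybe using (Maybe; nothing; just)
import Data.Maybe as Maybe
open import Data.Bool using (if_then_else_)
open import Data.Product using (_×_; _,_)
open import Data.List using (List; []; _∷_; _++_; map; concatMap; allFin; upTo; filterᵇ; foldr)
open import Data.Nat.ListAction using (sum; product)
open import Data.Vec using (Vec; replicate; zipWith; toList; updateAt)
import Data.Vec as Vec
open import Relation.Nullary.Decidable using (⌊_⌋)

-- Umbral side.
-- A polynomial with ℕ coefficients in k umbrae ν₀,…,ν_{k-1} is a formal
-- sum of terms  c · ν₀^{e₀} ⋯ ν_{k-1}^{e_{k-1}}  (list of (c , exponent vector)).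

Poly : ℕ → Set
Poly k = List (ℕ × Vec ℕ k)

const : ∀ {k} → ℕ → Poly k
const c = (c , replicate _ 0) ∷ []

var : ∀ {k} → Fin k → Poly k
var i = (1 , updateAt (replicate _ 0) i (λ _ → 1)) ∷ []

_⊕_ : ∀ {k} → Poly k → Poly k → Poly k
_⊕_ = _++_

_⊗_ : ∀ {k} → Poly k → Poly k → Poly k
P ⊗ Q = concatMap (λ { (c , e) → map (λ { (d , f) → (c * d , zipWith _+_ e f) }) Q }) P

one : ∀ {k} → Poly k
one = const 1

-- The evaluation E for k distinct umbrae each exchangeable with an umbra μ
-- with moments m : E[μ^i] = m i.  E is linear and, the umbrae being distinct,
-- E[ν₀^{e₀}⋯ν_{k-1}^{e_{k-1}}] = Π E[νᵢ^{eᵢ}] = Π m eᵢ.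
E : ∀ {k} → (ℕ → ℕ) → Poly k → ℕ
E m P = sum (map (λ { (c , e) → c * product (map m (toList e)) }) P)

-- Umbrae μ₁,…,μ_n are represented by var 0,…,var (n-1).
-- partial x j = x + μ₁ + ⋯ + μ_j   (the variables of index < j)
partial : ∀ {k} → ℕ → ℕ → Poly k
partial {k} x j = foldr _⊕_ (const x) (map var (filterᵇ (λ i → toℕ i <ᵇ j) (allFin k)))

umbralProduct : (n : ℕ) → ℕ → Poly n
umbralProduct n x = foldr _⊗_ one (map (partial x) (upTo n))

-- An increasing rooted forest on vertices 0,…,n-1 (labels 1,…,n), given by
-- parent pointers: vertex n of (F ∷ p) is either a root (p = nothing) or has
-- parent p = just j with j < n.

data IncForest : ℕ → Set where
  [] : IncForest zero
  _∷_ : ∀ {n} → IncForest n → Maybe (Fin n) → IncForest (suc n)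

allForests : (n : ℕ) → List (IncForest n)
allForests zero = [] ∷ []
allForests (suc n) =
  concatMap (λ F → (F ∷ nothing) ∷ map (λ j → F ∷ just j) (allFin n)) (allForests n)

roots : ∀ {n} → IncForest n → ℕ
roots [] = 0
roots (F ∷ nothing) = suc (roots F)
roots (F ∷ just _) = roots F

-- nothing if i is the last vertex n, just i otherwise
lowerLast : ∀ {n} → Fin (suc n) → Maybe (Fin n)
lowerLast {zero} zero = nothing
lowerLast {suc n} zero = just zero
lowerLast {suc n} (suc i) = Maybe.map suc (lowerLast i)

isParent : ∀ {n} → Maybe (Fin n) → Fin n → ℕ
isParent nothing i = 0
isParent (just j) i = if ⌊ j ≟ i ⌋ then 1 else 0

outdeg : ∀ {n} → IncForest n → Fin n → ℕ
outdeg (F ∷ p) i with lowerLast i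
... | nothing = 0
... | just i′ = outdeg F i′ + isParent p i′

colourings : ∀ {n} → ℕ → (ℕ → ℕ) → IncForest n → ℕ
colourings {n} x m F = x ^ roots F * product (map (λ i → m (outdeg F i)) (allFin n))

forestCount : ℕ → ℕ → (ℕ → ℕ) → ℕ
forestCount n x m = sum (map (colourings x m) (allForests n))

-- Expanding x (x + μ₁) ⋯ (x + μ₁ + ⋯ + μ_{n-1}) by choosing one summand from every factor is
-- building an increasing forest vertex by vertex: in the factor x + μ₁ + ⋯ + μ_j, the summand x
-- makes vertex j a new root and μ_{p+1} makes it a child of p < j.  The exponent of μ_{p+1} in
-- the resulting monomial is then the outdegree of p, so E turns the monomial into
-- x^{#roots} ∏ m (outdegree), the number of colourings of the forest.  To run the induction one
-- fixes a forest F on the first j vertices: the coloured forests extending F are counted by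
-- x^{#roots F} E[μ^{outdeg F} (x + μ₁ + ⋯ + μ_j) ⋯ (x + μ₁ + ⋯ + μ_{n-1})],
-- since both sides obey the recursion obtained by attaching vertex j.

module Submission where

open import Defs
open import Data.Nat using (ℕ; _≤_)
open import Relation.Binary.PropositionalEquality using (_≡_)

open import Algebra.Properties.CommutativeSemigroup using (xy∙z≈y∙xz; x∙yz≈y∙xz)
open import Data.Bool using (Bool; true; false; if_then_else_)
open import Data.Fin using (Fin; zero; suc; toℕ; _≟_)
open import Data.Fin.Properties using (toℕ<n)
open import Data.List using (List; []; _∷_; _++_; map; concatMap; allFin; applyUpTo; filterᵇ; foldr)
import Data.List as List
open import Data.List.Properties
  using (map-++; map-∘; map-cong; map-tabulate; concatMap-++; ++-identityʳ)
import Data.List.Properties as List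
open import Data.Maybe using (Maybe; nothing; just)
open import Data.Nat using (zero; suc; _+_; _*_; _^_; _<_; _<ᵇ_; _≡ᵇ_; s≤s)
open import Data.Nat.ListAction using (sum; product)
open import Data.Nat.ListAction.Properties using (sum-++)
open import Data.Nat.Properties
  using (+-identityʳ; +-assoc; +-suc; *-identityˡ; *-assoc; *-distribˡ-+; *-zeroʳ;
         +-commutativeSemigroup; *-commutativeSemigroup; +-*-semiring;
         ≤-refl; m≤n⇒m≤1+n; <-≤-trans; m≤m+n)
open import Data.Product using (_×_; _,_)
open import Data.Vec using (Vec; replicate; zipWith; toList; updateAt)
import Data.Vec as Vec
open import Data.Vec.Properties
  using (zipWith-assoc; zipWith-identityˡ; zipWith-identityʳ; tabulate-cong; tabulate-∘; map-const)
open import Algebra.Properties.Semiring.Sum +-*-semiring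
  using (sum-syntax; sum-cong-≗; sum-replicate-zero; *-distribˡ-sum)
open import Function using (_∘_; id)
open import Relation.Binary.PropositionalEquality
  using (refl; sym; trans; cong; cong₂; subst; _≗_; module ≡-Reasoning)
open import Relation.Nullary.Decidable using (⌊_⌋; ⌊⌋-map′)

private
  variable
    A B : Set

*-distribˡ-sum-map : ∀ c (h : A → ℕ) (l : List A) →
  c * sum (map h l) ≡ sum (map (λ a → c * h a) l)
*-distribˡ-sum-map c h [] = *-zeroʳ c
*-distribˡ-sum-map c h (a ∷ l) =
  trans (*-distribˡ-+ c (h a) _) (cong (c * h a +_) (*-distribˡ-sum-map c h l))

sum-map-++ : ∀ (h : A → ℕ) (l l′ : List A) →
  sum (map h (l ++ l′)) ≡ sum (map h l) + sum (map h l′)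
sum-map-++ h l l′ = trans (cong sum (map-++ h l l′)) (sum-++ (map h l) (map h l′))

sum-map-concatMap : ∀ (h : B → ℕ) (s : A → List B) (l : List A) →
  sum (map h (concatMap s l)) ≡ sum (map (λ a → sum (map h (s a))) l)
sum-map-concatMap h s [] = refl
sum-map-concatMap h s (a ∷ l) =
  trans (sum-map-++ h (s a) (concatMap s l)) (cong (sum (map h (s a)) +_) (sum-map-concatMap h s l))

sum-map-tabulate : ∀ {n} (h : A → ℕ) (f : Fin n → A) →
  sum (map h (List.tabulate f)) ≡ ∑[ i < n ] h (f i)
sum-map-tabulate {n = zero} h f = refl
sum-map-tabulate {n = suc n} h f = cong (h (f zero) +_) (sum-map-tabulate h (f ∘ suc))

sum-map-filterᵇ-tabulate : ∀ {n} (h : A → ℕ) (P : A → Bool) (f : Fin n → A) →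
  sum (map h (filterᵇ P (List.tabulate f))) ≡ ∑[ i < n ] (if P (f i) then h (f i) else 0)
sum-map-filterᵇ-tabulate {n = zero} h P f = refl
sum-map-filterᵇ-tabulate {n = suc n} h P f with P (f zero)
... | true = cong (h (f zero) +_) (sum-map-filterᵇ-tabulate h P (f ∘ suc))
... | false = sum-map-filterᵇ-tabulate h P (f ∘ suc)

∑-if-<ᵇ : ∀ {n a} (g : ℕ → ℕ) → a ≤ n →
  ∑[ i < n ] (if toℕ i <ᵇ a then g (toℕ i) else 0) ≡ ∑[ i < a ] g (toℕ i)
∑-if-<ᵇ {n} {zero} g _ = sum-replicate-zero n
∑-if-<ᵇ {suc n} {suc a} g (s≤s a≤n) = cong (g 0 +_) (∑-if-<ᵇ (g ∘ suc) a≤n)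

applyUpTo-cong : ∀ {f g : ℕ → A} → f ≗ g → ∀ r → applyUpTo f r ≡ applyUpTo g r
applyUpTo-cong f≗g zero = refl
applyUpTo-cong f≗g (suc r) = cong₂ _∷_ (f≗g 0) (applyUpTo-cong (f≗g ∘ suc) r)

applyUpTo-+-suc : ∀ j r → applyUpTo (j +_) (suc r) ≡ j ∷ applyUpTo (suc j +_) r
applyUpTo-+-suc j r = cong₂ _∷_ (+-identityʳ j) (applyUpTo-cong (+-suc j) r)

toList-tabulate : ∀ {n} (f : Fin n → A) → toList (Vec.tabulate f) ≡ List.tabulate f
toList-tabulate {n = zero} f = refl
toList-tabulate {n = suc n} f = cong (f zero ∷_) (toList-tabulate (f ∘ suc))

<⇒≡ᵇ≡false : ∀ {a b} → a < b → (a ≡ᵇ b) ≡ false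
<⇒≡ᵇ≡false {zero} {suc b} _ = refl
<⇒≡ᵇ≡false {suc a} {suc b} (s≤s a<b) = <⇒≡ᵇ≡false a<b

⌊≟⌋≡toℕ-≡ᵇ : ∀ {n} (i j : Fin n) → ⌊ i ≟ j ⌋ ≡ (toℕ i ≡ᵇ toℕ j)
⌊≟⌋≡toℕ-≡ᵇ zero zero = refl
⌊≟⌋≡toℕ-≡ᵇ zero (suc j) = refl
⌊≟⌋≡toℕ-≡ᵇ (suc i) zero = refl
⌊≟⌋≡toℕ-≡ᵇ (suc i) (suc j) = trans (⌊⌋-map′ _ _ (i ≟ j)) (⌊≟⌋≡toℕ-≡ᵇ i j)

-- Exponent vectors are taken as the first k values of a function ℕ → ℕ, so that one outdegree
-- function serves every number k of umbrae.
prefix : ∀ {k} → (ℕ → ℕ) → Vec ℕ k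
prefix g = Vec.tabulate (g ∘ toℕ)

_+δ_ : (ℕ → ℕ) → ℕ → ℕ → ℕ
(g +δ a) b = g b + (if a ≡ᵇ b then 1 else 0)

unitVector : ∀ {k} → Fin k → Vec ℕ k
unitVector i = updateAt (replicate _ 0) i (λ _ → 1)

prefix-const-0 : ∀ k → prefix {k} (λ _ → 0) ≡ replicate k 0
prefix-const-0 k = trans (tabulate-∘ (λ _ → 0) id) (map-const _ 0)

zipWith-prefix-unitVector : ∀ {k} (g : ℕ → ℕ) (i : Fin k) →
  zipWith _+_ (prefix g) (unitVector i) ≡ prefix (g +δ toℕ i)
zipWith-prefix-unitVector g zero = cong (g 0 + 1 Vec.∷_)
  (trans (zipWith-identityʳ +-identityʳ (prefix (g ∘ suc)))
         (tabulate-cong (λ i → sym (+-identityʳ _))))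
zipWith-prefix-unitVector g (suc i) = cong (g 0 + 0 Vec.∷_) (zipWith-prefix-unitVector (g ∘ suc) i)

module Evaluation (m : ℕ → ℕ) where

  moment : ∀ {k} → Vec ℕ k → ℕ
  moment e = product (map m (toList e))

  termValue : ∀ {k} → Vec ℕ k → ℕ × Vec ℕ k → ℕ
  termValue e (c , f) = c * moment (zipWith _+_ e f)

  -- E⟨ e ⟩ P = E[ν^e P] for the umbrae ν of Poly k.
  E⟨_⟩ : ∀ {k} → Vec ℕ k → Poly k → ℕ
  E⟨ e ⟩ P = sum (map (termValue e) P)

  E≡E⟨0⟩ : ∀ {k} (P : Poly k) → E m P ≡ E⟨ replicate k 0 ⟩ P
  E≡E⟨0⟩ P = cong sum (map-cong (λ { (c , f) →
    cong (λ e → c * moment e) (sym (zipWith-identityˡ (λ _ → refl) f)) }) P)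

  E⟨⟩-one : ∀ {k} (e : Vec ℕ k) → E⟨ e ⟩ one ≡ moment e
  E⟨⟩-one e = trans (+-identityʳ _)
    (trans (*-identityˡ _) (cong moment (zipWith-identityʳ +-identityʳ e)))

  E⟨⟩-⊕-⊗ : ∀ {k} (e : Vec ℕ k) P P′ Q →
    E⟨ e ⟩ ((P ⊕ P′) ⊗ Q) ≡ E⟨ e ⟩ (P ⊗ Q) + E⟨ e ⟩ (P′ ⊗ Q)
  E⟨⟩-⊕-⊗ e P P′ Q =
    trans (cong E⟨ e ⟩ (concatMap-++ _ P P′)) (sum-map-++ (termValue e) (P ⊗ Q) (P′ ⊗ Q))

  E⟨⟩-monomial-⊗ : ∀ {k} (e : Vec ℕ k) c f (Q : Poly k) →
    E⟨ e ⟩ (((c , f) ∷ []) ⊗ Q) ≡ c * E⟨ zipWith _+_ e f ⟩ Q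
  E⟨⟩-monomial-⊗ e c f Q = begin
      sum (map (termValue e) (map scale Q ++ []))
    ≡⟨ cong (sum ∘ map (termValue e)) (++-identityʳ (map scale Q)) ⟩
      sum (map (termValue e) (map scale Q))
    ≡⟨ cong sum (sym (map-∘ Q)) ⟩
      sum (map (termValue e ∘ scale) Q)
    ≡⟨ cong sum (map-cong (λ { (d , g) → shift d g }) Q) ⟩
      sum (map (λ t → c * termValue (zipWith _+_ e f) t) Q)
    ≡⟨ sym (*-distribˡ-sum-map c (termValue (zipWith _+_ e f)) Q) ⟩
      c * E⟨ zipWith _+_ e f ⟩ Q
    ∎
    where
      open ≡-Reasoning
      scale : ℕ × Vec ℕ _ → ℕ × Vec ℕ _
      scale (d , g) = (c * d , zipWith _+_ f g)
      shift : ∀ d g → c * d * moment (zipWith _+_ e (zipWith _+_ f g))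
                    ≡ c * (d * moment (zipWith _+_ (zipWith _+_ e f) g))
      shift d g = trans (*-assoc c d _)
        (cong (λ v → c * (d * moment v)) (sym (zipWith-assoc +-assoc e f g)))

  E⟨⟩-const⊕vars-⊗ : ∀ {k} (e : Vec ℕ k) c (Q : Poly k) (l : List (Fin k)) →
    E⟨ e ⟩ (foldr _⊕_ (const c) (map var l) ⊗ Q)
      ≡ c * E⟨ e ⟩ Q + sum (map (λ i → E⟨ zipWith _+_ e (unitVector i) ⟩ Q) l)
  E⟨⟩-const⊕vars-⊗ e c Q [] = trans (E⟨⟩-monomial-⊗ e c _ Q)
    (trans (cong (λ v → c * E⟨ v ⟩ Q) (zipWith-identityʳ +-identityʳ e)) (sym (+-identityʳ _)))
  E⟨⟩-const⊕vars-⊗ e c Q (i ∷ l) = begin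
      E⟨ e ⟩ ((var i ⊕ rest) ⊗ Q)
    ≡⟨ E⟨⟩-⊕-⊗ e (var i) rest Q ⟩
      E⟨ e ⟩ (var i ⊗ Q) + E⟨ e ⟩ (rest ⊗ Q)
    ≡⟨ cong₂ _+_ (trans (E⟨⟩-monomial-⊗ e 1 (unitVector i) Q) (*-identityˡ _))
                 (E⟨⟩-const⊕vars-⊗ e c Q l) ⟩
      E⟨ e+μᵢ ⟩ Q + (c * E⟨ e ⟩ Q + sum (map (λ i → E⟨ zipWith _+_ e (unitVector i) ⟩ Q) l))
    ≡⟨ x∙yz≈y∙xz +-commutativeSemigroup (E⟨ e+μᵢ ⟩ Q) (c * E⟨ e ⟩ Q) _ ⟩
      c * E⟨ e ⟩ Q + sum (map (λ i → E⟨ zipWith _+_ e (unitVector i) ⟩ Q) (i ∷ l))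
    ∎
    where
      open ≡-Reasoning
      rest = foldr _⊕_ (const c) (map var l)
      e+μᵢ = zipWith _+_ e (unitVector i)

  E⟨⟩-partial-⊗ : ∀ {k a} x (g : ℕ → ℕ) (Q : Poly k) → a ≤ k →
    E⟨ prefix g ⟩ (partial x a ⊗ Q)
      ≡ x * E⟨ prefix g ⟩ Q + ∑[ p < a ] E⟨ prefix (g +δ toℕ p) ⟩ Q
  E⟨⟩-partial-⊗ {k} {a} x g Q a≤k = begin
      E⟨ prefix g ⟩ (partial x a ⊗ Q)
    ≡⟨ E⟨⟩-const⊕vars-⊗ (prefix g) x Q vars ⟩
      x * E⟨ prefix g ⟩ Q + sum (map (λ i → E⟨ zipWith _+_ (prefix g) (unitVector i) ⟩ Q) vars)
    ≡⟨ cong (x * E⟨ prefix g ⟩ Q +_) (cong sum (map-cong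
         (λ i → cong (λ e → E⟨ e ⟩ Q) (zipWith-prefix-unitVector g i)) vars)) ⟩
      x * E⟨ prefix g ⟩ Q + sum (map (λ i → E⟨ prefix (g +δ toℕ i) ⟩ Q) vars)
    ≡⟨ cong (x * E⟨ prefix g ⟩ Q +_) (sum-map-filterᵇ-tabulate
         (λ i → E⟨ prefix (g +δ toℕ i) ⟩ Q) (λ i → toℕ i <ᵇ a) (id {A = Fin k})) ⟩
      x * E⟨ prefix g ⟩ Q + ∑[ i < k ] (if toℕ i <ᵇ a then E⟨ prefix (g +δ toℕ i) ⟩ Q else 0)
    ≡⟨ cong (x * E⟨ prefix g ⟩ Q +_) (∑-if-<ᵇ (λ b → E⟨ prefix (g +δ b) ⟩ Q) a≤k) ⟩
      x * E⟨ prefix g ⟩ Q + ∑[ p < a ] E⟨ prefix (g +δ toℕ p) ⟩ Q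
    ∎
    where
      open ≡-Reasoning
      vars = filterᵇ (λ i → toℕ i <ᵇ a) (allFin k)

childCount : ∀ {j} → IncForest j → ℕ → ℕ
childCount [] = λ _ → 0
childCount (F ∷ nothing) = childCount F
childCount (F ∷ just p) = childCount F +δ toℕ p

childCount≡0 : ∀ {j} (F : IncForest j) {b} → j ≤ suc b → childCount F b ≡ 0
childCount≡0 [] _ = refl
childCount≡0 (F ∷ nothing) (s≤s j≤b) = childCount≡0 F (m≤n⇒m≤1+n j≤b)
childCount≡0 (F ∷ just p) (s≤s j≤b)
  rewrite childCount≡0 F (m≤n⇒m≤1+n j≤b) | <⇒≡ᵇ≡false (<-≤-trans (toℕ<n p) j≤b) = refl

toℕ-lowerLast-nothing : ∀ {n} (i : Fin (suc n)) → lowerLast i ≡ nothing → toℕ i ≡ n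
toℕ-lowerLast-nothing {zero} zero _ = refl
toℕ-lowerLast-nothing {suc n} (suc i) eq with lowerLast i in eq′
toℕ-lowerLast-nothing {suc n} (suc i) refl | nothing = cong suc (toℕ-lowerLast-nothing i eq′)

toℕ-lowerLast-just : ∀ {n} (i : Fin (suc n)) {i′} →
  lowerLast i ≡ just i′ → toℕ i′ ≡ toℕ i
toℕ-lowerLast-just {suc n} zero refl = refl
toℕ-lowerLast-just {suc n} (suc i) eq with lowerLast i in eq′
toℕ-lowerLast-just {suc n} (suc i) refl | just _ = cong suc (toℕ-lowerLast-just i eq′)

outdeg≡childCount : ∀ {j} (F : IncForest j) (i : Fin j) → outdeg F i ≡ childCount F (toℕ i)
outdeg≡childCount {suc j} (F ∷ p) i with lowerLast i in eq
... | nothing rewrite toℕ-lowerLast-nothing i eq = sym (childCount≡0 (F ∷ p) ≤-refl)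
... | just i′ rewrite sym (toℕ-lowerLast-just i eq) = newEdge p
  where
    newEdge : (p : Maybe (Fin j)) → outdeg F i′ + isParent p i′ ≡ childCount (F ∷ p) (toℕ i′)
    newEdge nothing = trans (+-identityʳ _) (outdeg≡childCount F i′)
    newEdge (just q) =
      cong₂ _+_ (outdeg≡childCount F i′) (cong (if_then 1 else 0) (⌊≟⌋≡toℕ-≡ᵇ q i′))

module Counting (x : ℕ) (m : ℕ → ℕ) where
  open Evaluation m

  colourings≡x^roots*moment : ∀ {j} (F : IncForest j) →
    colourings x m F ≡ x ^ roots F * moment (prefix {j} (childCount F))
  colourings≡x^roots*moment {j} F = cong (x ^ roots F *_) (begin
      product (map (m ∘ outdeg F) (allFin j))
    ≡⟨ cong product (map-tabulate (id {A = Fin j}) (m ∘ outdeg F)) ⟩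
      product (List.tabulate (m ∘ outdeg F))
    ≡⟨ cong product (List.tabulate-cong (λ i → cong m (outdeg≡childCount F i))) ⟩
      product (List.tabulate (m ∘ childCount F ∘ toℕ {j}))
    ≡⟨ cong product (sym (map-tabulate (childCount F ∘ toℕ {j}) m)) ⟩
      product (map m (List.tabulate (childCount F ∘ toℕ {j})))
    ≡⟨ cong (product ∘ map m) (sym (toList-tabulate (childCount F ∘ toℕ {j}))) ⟩
      moment (prefix {j} (childCount F))
    ∎)
    where open ≡-Reasoning

  -- completions r F counts the coloured increasing forests on j + r vertices that restrict to F.
  completions : ∀ {j} → ℕ → IncForest j → ℕ
  completions zero F = colourings x m F
  completions {j} (suc r) F = completions r (F ∷ nothing) + ∑[ p < j ] completions r (F ∷ just p)

  sum-completions-allForests : ∀ n r →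
    sum (map (completions r) (allForests n)) ≡ completions (n + r) []
  sum-completions-allForests zero r = +-identityʳ _
  sum-completions-allForests (suc n) r = begin
      sum (map (completions r) (allForests (suc n)))
    ≡⟨ sum-map-concatMap (completions r) _ (allForests n) ⟩
      sum (map (λ F → completions r (F ∷ nothing) + sum (map (completions r) (children F)))
               (allForests n))
    ≡⟨ cong sum (map-cong (λ F → cong (completions r (F ∷ nothing) +_) (attach F))
                          (allForests n)) ⟩
      sum (map (completions (suc r)) (allForests n))
    ≡⟨ sum-completions-allForests n (suc r) ⟩
      completions (n + suc r) []
    ≡⟨ cong (λ s → completions s []) (+-suc n r) ⟩
      completions (suc n + r) []
    ∎
    where
      open ≡-Reasoning
      children : IncForest n → List (IncForest (suc n))
      children F = map (λ p → F ∷ just p) (allFin n)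
      attach : (F : IncForest n) →
        sum (map (completions r) (children F)) ≡ ∑[ p < n ] completions r (F ∷ just p)
      attach F =
        trans (cong (sum ∘ map (completions r)) (map-tabulate (id {A = Fin n}) (λ p → F ∷ just p)))
              (sum-map-tabulate (completions r) (λ p → F ∷ just p))

  partialProduct : ∀ {k} → List ℕ → Poly k
  partialProduct L = foldr _⊗_ one (map (partial x) L)

  completions≡E⟨⟩ : ∀ r {j k} (F : IncForest j) → j + r ≡ k →
    completions r F
      ≡ x ^ roots F * E⟨ prefix {k} (childCount F) ⟩ (partialProduct (applyUpTo (j +_) r))
  completions≡E⟨⟩ zero {j} F j+0≡k with trans (sym (+-identityʳ j)) j+0≡k
  ... | refl = trans (colourings≡x^roots*moment F)
                     (cong (x ^ roots F *_) (sym (E⟨⟩-one (prefix {j} (childCount F)))))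
  completions≡E⟨⟩ (suc r) {j} {k} F j+1+r≡k = begin
      completions r (F ∷ nothing) + ∑[ p < j ] completions r (F ∷ just p)
    ≡⟨ cong₂ _+_ (ih (F ∷ nothing)) (sum-cong-≗ (λ p → ih (F ∷ just p))) ⟩
      x * x ^ roots F * E⟨ prefix g ⟩ Q + ∑[ p < j ] (x ^ roots F * E⟨ prefix (g +δ toℕ p) ⟩ Q)
    ≡⟨ cong₂ _+_ (xy∙z≈y∙xz *-commutativeSemigroup x (x ^ roots F) _)
                 (sym (*-distribˡ-sum {j} (x ^ roots F) (λ p → E⟨ prefix (g +δ toℕ p) ⟩ Q))) ⟩
      x ^ roots F * (x * E⟨ prefix g ⟩ Q) + x ^ roots F * ∑[ p < j ] E⟨ prefix (g +δ toℕ p) ⟩ Q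
    ≡⟨ sym (*-distribˡ-+ (x ^ roots F) _ _) ⟩
      x ^ roots F * (x * E⟨ prefix g ⟩ Q + ∑[ p < j ] E⟨ prefix (g +δ toℕ p) ⟩ Q)
    ≡⟨ cong (x ^ roots F *_) (sym (E⟨⟩-partial-⊗ x g Q j≤k)) ⟩
      x ^ roots F * E⟨ prefix {k} g ⟩ (partialProduct (j ∷ applyUpTo (suc j +_) r))
    ≡⟨ cong (λ L → x ^ roots F * E⟨ prefix {k} g ⟩ (partialProduct L))
            (sym (applyUpTo-+-suc j r)) ⟩
      x ^ roots F * E⟨ prefix {k} g ⟩ (partialProduct (applyUpTo (j +_) (suc r)))
    ∎
    where
      open ≡-Reasoning
      g = childCount F
      Q : Poly k
      Q = partialProduct (applyUpTo (suc j +_) r)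
      j≤k : j ≤ k
      j≤k = subst (j ≤_) j+1+r≡k (m≤m+n j (suc r))
      ih : (F′ : IncForest (suc j)) →
        completions r F′ ≡ x ^ roots F′ * E⟨ prefix (childCount F′) ⟩ Q
      ih F′ = completions≡E⟨⟩ r F′ (trans (sym (+-suc j r)) j+1+r≡k)

proposition5p10 : (x : ℕ) (m : ℕ → ℕ) → m 0 ≡ 1 → (n : ℕ) → 1 ≤ n →
    E m (umbralProduct n x) ≡ forestCount n x m
proposition5p10 x m _ n _ = begin
    E m (umbralProduct n x)
  ≡⟨ E≡E⟨0⟩ (umbralProduct n x) ⟩
    E⟨ replicate n 0 ⟩ (umbralProduct n x)
  ≡⟨ cong (λ e → E⟨ e ⟩ (umbralProduct n x)) (sym (prefix-const-0 n)) ⟩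
    E⟨ prefix (childCount []) ⟩ (umbralProduct n x)
  ≡⟨ sym (*-identityˡ _) ⟩
    x ^ roots [] * E⟨ prefix (childCount []) ⟩ (partialProduct (applyUpTo (0 +_) n))
  ≡⟨ sym (completions≡E⟨⟩ n [] refl) ⟩
    completions n []
  ≡⟨ cong (λ s → completions s []) (sym (+-identityʳ n)) ⟩
    completions (n + 0) []
  ≡⟨ sym (sum-completions-allForests n 0) ⟩
    forestCount n x m
  ∎
  where
    open ≡-Reasoning
    open Evaluation m
    open Counting x m
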